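{- Let $r,c,\ell$ be nonnegative integers with $\ell\le rc$. The stationary probability of $A\in S_{r\times c,\ell}$ for the several jugglers Markov chain described in the context is $$\pi(A)=\frac{1}{Z_{r\times c,\ell}}\prod_{i=1}^r\bigl(ci-A_{<i}\bigr)_{A_i},$$ where $A_i$ is the number of balls in row $i$ of $A$, $A_{<i}=A_1+\cdots+A_{i-1}$, $(x)_m=x(x-1)\cdots(x-m+1)$ denotes the falling factorial, and $Z_{r\times c,\ell}$ is the normalization factor.
   Context: $S_{r\times c}$ is the set of rectangular arrays with $r$ rows (numbered $1,\ldots,r$ from top to bottom) and $c$ columns in which each cell is either empty or contains one ball; $S_{r\times c,\ell}$ is the subset of arrays with exactly $\ell$ balls. For $A\in S_{r\times c}$, $A^-$ is obtained by removing all balls of the bottom row $r$ and moving every other ball down one row (so the top row of $A^-$ is empty). $A\subset B$ means every ball of $A$ is a ball of $B$ (same cell). The transition probability from $A$ to $B$ in $S_{r\times c,\ell}$ is $1/\binom{rc-\ell+A_r}{A_r}$ if $A^-\subset B$, and $0$ otherwise (the $A_r$ balls from the bottom row are reinjected uniformly into distinct empty cells of $A^-$). -}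

module Defs where

open import Data.Bool using (Bool; true; false; if_then_else_; _∧_; _∨_; not)
open import Data.Nat using (ℕ; zero; suc; _+_; _*_; _∸_)
open import Data.Nat.Combinatorics using (_C_)
open import Data.List using (List; []; _∷_; concatMap; map; filter; foldr)
open import Data.Vec using (Vec; []; _∷_; replicate; init; last; zipWith; foldr′)
open import Data.Integer using (+_)
open import Data.Rational using (ℚ; 0ℚ; _/_) renaming (_+_ to _+ℚ_; _*_ to _*ℚ_)
open import Data.Nat using (_≟_)
open import Relation.Binary.PropositionalEquality using (_≡_)

-- An r×c array: r rows (top to bottom), each row a vector of c cells;
-- true = the cell contains a ball.
Array : ℕ → ℕ → Set
Array r c = Vec (Vec Bool c) r

rowCount : ∀ {c} → Vec Bool c → ℕ
rowCount [] = 0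
rowCount (true ∷ xs) = suc (rowCount xs)
rowCount (false ∷ xs) = rowCount xs

balls : ∀ {r c} → Array r c → ℕ
balls [] = 0
balls (row ∷ rows) = rowCount row + balls rows

allRows : (n : ℕ) → List (Vec Bool n)
allRows zero = [] ∷ []
allRows (suc n) = concatMap (λ v → (false ∷ v) ∷ (true ∷ v) ∷ []) (allRows n)

allArrays : (r c : ℕ) → List (Array r c)
allArrays zero c = [] ∷ []
allArrays (suc r) c =
  concatMap (λ rest → map (λ row → row ∷ rest) (allRows c)) (allArrays r c)

S : (r c ℓ : ℕ) → List (Array r c)
S r c ℓ = filter (λ A → balls A ≟ ℓ) (allArrays r c)

bottomCount : ∀ {r c} → Array r c → ℕ
bottomCount {zero} [] = 0
bottomCount {suc r} A = rowCount (last A)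

shiftDown : ∀ {r c} → Array r c → Array r c
shiftDown {zero} [] = []
shiftDown {suc r} {c} A = replicate c false ∷ init A

rowSub : ∀ {c} → Vec Bool c → Vec Bool c → Bool
rowSub [] [] = true
rowSub (a ∷ as) (b ∷ bs) = (not a ∨ b) ∧ rowSub as bs

sub : ∀ {r c} → Array r c → Array r c → Bool
sub [] [] = true
sub (a ∷ as) (b ∷ bs) = rowSub a b ∧ sub as bs

-- 1/n as a rational, with the harmless convention 1/0 = 0
-- (only ever applied to binomial coefficients (n choose k) with k ≤ n, which are ≥ 1)
inv : ℕ → ℚ
inv zero = 0ℚ
inv (suc n) = (+ 1) / suc n

trans : (r c ℓ : ℕ) → Array r c → Array r c → ℚ
trans r c ℓ A B =
  if sub (shiftDown A) B
  then inv (((r * c ∸ ℓ) + bottomCount A) C bottomCount A)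
  else 0ℚ

falling : ℕ → ℕ → ℕ
falling x zero = 1
falling x (suc m) = x * falling (x ∸ 1) m

-- ∏_{i} (c i - A_{<i})_{A_i}, with i the index of the first remaining row
-- and p = A_{<i}
weightFrom : ∀ {r} (c i p : ℕ) → Array r c → ℕ
weightFrom c i p [] = 1
weightFrom c i p (row ∷ rows) =
  falling (c * i ∸ p) (rowCount row) * weightFrom c (suc i) (p + rowCount row) rows

weight : ∀ {r c} → Array r c → ℕ
weight {c = c} A = weightFrom c 1 0 A

sumℚ : ∀ {X : Set} → (X → ℚ) → List X → ℚ
sumℚ f = foldr (λ x acc → f x +ℚ acc) 0ℚ

sumℕ : ∀ {X : Set} → (X → ℕ) → List X → ℕ
sumℕ f = foldr (λ x acc → f x + acc) 0

Z : (r c ℓ : ℕ) → ℕ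
Z r c ℓ = sumℕ weight (S r c ℓ)

π : (r c ℓ : ℕ) → Array r c → ℚ
π r c ℓ A = ((+ weight A) / 1) *ℚ inv (Z r c ℓ)

module Submission where

-- Write W u A = Π_i (u_i)_{A_i} with u_1 = u and u_{i+1} = u_i + (c - A_i), so that
-- weight A = W c A.  For a target B = b ∷ B⁻ the move A → B is possible iff every upper
-- row of A is contained in the corresponding row of B⁻, and its probability 1/C(N, A_r) cancels
-- the bottom factor (N)_{A_r} = A_r! C(N, A_r) of W c A (W-factor, binomialTop).  Hence
-- π(A) P(A → B) = Q c A B⁻ / Z, where Q replaces that bottom factor by A_r! (flow), and the
-- balance equation becomes the counting identity (sum-Q)
--     Σ_{|A| = s + |B⁻|} Q x A B⁻ = (c)_s W (x + (c - s)) B⁻,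
-- proved by induction on the rows: summing out the top row is Vandermonde's identity over
-- subrows (subset-vandermonde), the one-row case counts ordered choices (sum-orderedTerm).

open import Defs
open import Data.Bool using (Bool; true; false; if_then_else_; T)
open import Data.Nat
  using (ℕ; zero; suc; _+_; _*_; _∸_; _⊓_; _!; _≤_; _<_; >-nonZero; z≤n; s≤s; _≡ᵇ_; _≟_; _≤?_)
open import Data.Nat.Properties
open import Data.Nat.Combinatorics using (_C_; nCk+nC[k+1]≡[n+1]C[k+1])
open import Data.Nat.Combinatorics.Specification using (k>n⇒nCk≡0)
open import Data.Nat.Tactic.RingSolver using (solve-∀)
open import Data.List using (List; []; _∷_; map; concatMap; filter; _++_)
open import Data.List.Membership.Propositional using (_∈_)
open import Data.List.Membership.Propositional.Properties using (∈-map⁺; ∈-concat⁺′; ∈-filter⁺)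
open import Data.List.Relation.Unary.All as All using (All; []; _∷_)
open import Data.List.Relation.Unary.All.Properties using (all-filter)
open import Data.List.Relation.Unary.Any using (here; there)
open import Data.Vec using (Vec; []; _∷_; replicate; init; last)
open import Data.Product using (_×_; _,_)
open import Data.Empty using (⊥-elim)
open import Relation.Nullary using (yes; no)
open import Relation.Binary.PropositionalEquality
  using (_≡_; _≢_; refl; sym; cong; cong₂; subst; module ≡-Reasoning)
  renaming (trans to ≡-trans)
import Data.Integer as ℤ
import Data.Integer.Properties as ℤP
open import Data.Rational using (ℚ; 0ℚ; _/_; toℚᵘ) renaming (_+_ to _+ℚ_; _*_ to _*ℚ_)
import Data.Rational.Properties as ℚP
open import Data.Rational.Unnormalised using (mkℚᵘ; *≡*) renaming (_≃_ to _≃ᵘ_; _+_ to _+ᵘ_; _*_ to _*ᵘ_)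
import Data.Rational.Unnormalised.Properties as ℚᵘP

open ≡-Reasoning

sum-cong : ∀ {X : Set} {f g : X → ℕ} (L : List X) → (∀ x → f x ≡ g x) → sumℕ f L ≡ sumℕ g L
sum-cong [] _ = refl
sum-cong (x ∷ L) f≗g = cong₂ _+_ (f≗g x) (sum-cong L f≗g)

sum-zero : ∀ {X : Set} (L : List X) → sumℕ (λ _ → 0) L ≡ 0
sum-zero [] = refl
sum-zero (_ ∷ L) = sum-zero L

sum-+ : ∀ {X : Set} (f g : X → ℕ) (L : List X) → sumℕ (λ x → f x + g x) L ≡ sumℕ f L + sumℕ g L
sum-+ f g [] = refl
sum-+ f g (x ∷ L) = ≡-trans (cong (f x + g x +_) (sum-+ f g L)) (interchange (f x) (g x) _ _)
  where
  interchange : ∀ a b c d → a + b + (c + d) ≡ a + c + (b + d)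
  interchange = solve-∀

sum-scale : ∀ {X : Set} (k : ℕ) (f : X → ℕ) (L : List X) → sumℕ (λ x → k * f x) L ≡ k * sumℕ f L
sum-scale k f [] = sym (*-zeroʳ k)
sum-scale k f (x ∷ L) = ≡-trans (cong (k * f x +_) (sum-scale k f L)) (sym (*-distribˡ-+ k (f x) _))

sum-++ : ∀ {X : Set} (f : X → ℕ) (L M : List X) → sumℕ f (L ++ M) ≡ sumℕ f L + sumℕ f M
sum-++ f [] M = refl
sum-++ f (x ∷ L) M = ≡-trans (cong (f x +_) (sum-++ f L M)) (sym (+-assoc (f x) _ _))

sum-map : ∀ {X Y : Set} (f : Y → ℕ) (h : X → Y) (L : List X) → sumℕ f (map h L) ≡ sumℕ (λ x → f (h x)) L
sum-map f h [] = refl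
sum-map f h (x ∷ L) = cong (f (h x) +_) (sum-map f h L)

sum-concatMap : ∀ {X Y : Set} (f : Y → ℕ) (g : X → List Y) (L : List X) →
  sumℕ f (concatMap g L) ≡ sumℕ (λ x → sumℕ f (g x)) L
sum-concatMap f g [] = refl
sum-concatMap f g (x ∷ L) = ≡-trans (sum-++ f (g x) (concatMap g L)) (cong (sumℕ f (g x) +_) (sum-concatMap f g L))

sum-swap : ∀ {X Y : Set} (g : X → Y → ℕ) (L : List X) (M : List Y) →
  sumℕ (λ x → sumℕ (g x) M) L ≡ sumℕ (λ y → sumℕ (λ x → g x y) L) M
sum-swap g [] M = sym (sum-zero M)
sum-swap g (x ∷ L) M =
  ≡-trans (cong (sumℕ (g x) M +_) (sum-swap g L M)) (sym (sum-+ (g x) (λ y → sumℕ (λ x → g x y) L) M))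

∈⇒≤sum : ∀ {X : Set} (f : X → ℕ) {x : X} {L : List X} → x ∈ L → f x ≤ sumℕ f L
∈⇒≤sum f (here refl) = m≤m+n _ _
∈⇒≤sum f {L = y ∷ L} (there x∈L) = ≤-trans (∈⇒≤sum f x∈L) (m≤n+m _ (f y))

-- The Kronecker delta, used to turn a sum over a filtered list into a weighted full sum;
-- δ-cancel lets it absorb ball counts row by row.

δ : ℕ → ℕ → ℕ
δ zero zero = 1
δ zero (suc n) = 0
δ (suc m) zero = 0
δ (suc m) (suc n) = δ m n

δ-refl : ∀ n → δ n n ≡ 1
δ-refl zero = refl
δ-refl (suc n) = δ-refl n

δ-≢ : ∀ m n → m ≢ n → δ m n ≡ 0
δ-≢ zero zero m≢n = ⊥-elim (m≢n refl)
δ-≢ zero (suc n) _ = refl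
δ-≢ (suc m) zero _ = refl
δ-≢ (suc m) (suc n) m≢n = δ-≢ m n (λ m≡n → m≢n (cong suc m≡n))

δ-cancel : ∀ a m n → δ (a + m) (a + n) ≡ δ m n
δ-cancel zero m n = refl
δ-cancel (suc a) m n = δ-cancel a m n

δ-scale : ∀ m s h → δ m s * (suc m * h) ≡ suc s * (δ m s * h)
δ-scale zero zero h = refl
δ-scale zero (suc s) h = sym (*-zeroʳ (suc s))
δ-scale (suc m) zero h = refl
δ-scale (suc m) (suc s) h = ≡-trans (*-distribˡ-+ (δ m s) h _) (cong (δ m s * h +_) (δ-scale m s h))

sum-filter : ∀ {X : Set} (f : X → ℕ) (b : X → ℕ) (ℓ : ℕ) (L : List X) →
  sumℕ f (filter (λ x → b x ≟ ℓ) L) ≡ sumℕ (λ x → δ (b x) ℓ * f x) L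
sum-filter f b ℓ [] = refl
sum-filter f b ℓ (x ∷ L) with b x ≡ᵇ ℓ in test
... | true = cong₂ _+_ (sym deltaOne) (sum-filter f b ℓ L)
  where
  deltaOne : δ (b x) ℓ * f x ≡ f x
  deltaOne = begin
    δ (b x) ℓ * f x ≡⟨ cong (λ n → δ n ℓ * f x) (≡ᵇ⇒≡ (b x) ℓ (subst T (sym test) _)) ⟩
    δ ℓ ℓ * f x     ≡⟨ cong (_* f x) (δ-refl ℓ) ⟩
    f x + 0         ≡⟨ +-identityʳ (f x) ⟩
    f x             ∎
... | false = ≡-trans (sum-filter f b ℓ L) (cong (_+ sumℕ (λ y → δ (b y) ℓ * f y) L) (sym (cong (_* f x) deltaZero)))
  where
  deltaZero : δ (b x) ℓ ≡ 0
  deltaZero = δ-≢ (b x) ℓ (λ bx≡ℓ → subst T test (≡⇒≡ᵇ (b x) ℓ bx≡ℓ))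

-- Choosing s + d in order = choosing s, then d among the remaining x - s.
falling-add : ∀ x s d → falling x (s + d) ≡ falling x s * falling (x ∸ s) d
falling-add x zero d = sym (+-identityʳ (falling x d))
falling-add x (suc s) d = begin
  x * falling (x ∸ 1) (s + d)                         ≡⟨ cong (x *_) (falling-add (x ∸ 1) s d) ⟩
  x * (falling (x ∸ 1) s * falling (x ∸ 1 ∸ s) d)     ≡⟨ cong (λ y → x * (falling (x ∸ 1) s * falling y d)) (∸-+-assoc x 1 s) ⟩
  x * (falling (x ∸ 1) s * falling (x ∸ suc s) d)     ≡⟨ sym (*-assoc x _ _) ⟩
  x * falling (x ∸ 1) s * falling (x ∸ suc s) d       ∎

falling-zero : ∀ x m → x < m → falling x m ≡ 0
falling-zero zero (suc m) _ = refl
falling-zero (suc x) (suc m) (s≤s x<m) = ≡-trans (cong (suc x *_) (falling-zero x m x<m)) (*-zeroʳ (suc x))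

falling-pos : ∀ x m → m ≤ x → 0 < falling x m
falling-pos x zero _ = s≤s z≤n
falling-pos (suc x) (suc m) (s≤s m≤x) = <-≤-trans (falling-pos x m m≤x) (m≤m+n (falling x m) (x * falling x m))

falling-pascal : ∀ n k → falling (suc n) (suc k) ≡ suc k * falling n k + falling n (suc k)
falling-pascal n k with k ≤? n
... | yes k≤n = begin
  suc n * falling n k                       ≡⟨ cong (λ m → suc m * falling n k) (sym (m+[n∸m]≡n k≤n)) ⟩
  (suc k + (n ∸ k)) * falling n k           ≡⟨ *-distribʳ-+ (falling n k) (suc k) (n ∸ k) ⟩
  suc k * falling n k + (n ∸ k) * falling n k ≡⟨ cong (suc k * falling n k +_) (sym lastFactor) ⟩
  suc k * falling n k + falling n (suc k)   ∎
  where
  lastFactor : falling n (suc k) ≡ (n ∸ k) * falling n k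
  lastFactor = begin
    falling n (suc k)                 ≡⟨ cong (falling n) (+-comm 1 k) ⟩
    falling n (k + 1)                 ≡⟨ falling-add n k 1 ⟩
    falling n k * ((n ∸ k) * 1)       ≡⟨ cong (falling n k *_) (*-identityʳ (n ∸ k)) ⟩
    falling n k * (n ∸ k)             ≡⟨ *-comm (falling n k) (n ∸ k) ⟩
    (n ∸ k) * falling n k             ∎
... | no k≰n = begin
  suc n * falling n k                     ≡⟨ cong (suc n *_) vanish ⟩
  suc n * 0                               ≡⟨ *-zeroʳ (suc n) ⟩
  0                                       ≡⟨ sym (≡-trans (+-identityʳ (suc k * 0)) (*-zeroʳ (suc k))) ⟩
  suc k * 0 + 0                           ≡⟨ cong₂ (λ p q → suc k * p + q) (sym vanish) (sym vanish′) ⟩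
  suc k * falling n k + falling n (suc k) ∎
  where
  vanish : falling n k ≡ 0
  vanish = falling-zero n k (≰⇒> k≰n)
  vanish′ : falling n (suc k) ≡ 0
  vanish′ = falling-zero n (suc k) (m<n⇒m<1+n (≰⇒> k≰n))

falling≡!*C : ∀ n k → falling n k ≡ k ! * (n C k)
falling≡!*C n zero = refl
falling≡!*C zero (suc k) = sym (≡-trans (cong (suc k ! *_) (k>n⇒nCk≡0 {0} {suc k} (s≤s z≤n))) (*-zeroʳ (suc k !)))
falling≡!*C (suc n) (suc k) = begin
  falling (suc n) (suc k)                          ≡⟨ falling-pascal n k ⟩
  suc k * falling n k + falling n (suc k)          ≡⟨ cong₂ (λ p q → suc k * p + q) (falling≡!*C n k) (falling≡!*C n (suc k)) ⟩
  suc k * (k ! * (n C k)) + suc k ! * (n C suc k)  ≡⟨ cong (_+ suc k ! * (n C suc k)) (sym (*-assoc (suc k) (k !) _)) ⟩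
  suc k ! * (n C k) + suc k ! * (n C suc k)        ≡⟨ sym (*-distribˡ-+ (suc k !) _ _) ⟩
  suc k ! * (n C k + n C suc k)                    ≡⟨ cong (suc k ! *_) (nCk+nC[k+1]≡[n+1]C[k+1] n k) ⟩
  suc k ! * (suc n C suc k)                        ∎

C-pos : ∀ {n k} → k ≤ n → 0 < n C k
C-pos {n} {k} k≤n = n≢0⇒n>0 λ nCk≡0 → <⇒≢ (falling-pos n k k≤n) (sym (begin
  falling n k     ≡⟨ falling≡!*C n k ⟩
  k ! * (n C k)   ≡⟨ cong (k ! *_) nCk≡0 ⟩
  k ! * 0         ≡⟨ *-zeroʳ (k !) ⟩
  0               ∎))

-- Splitting off one factor: (x+y)_{n+1} = y (x+y-1)_n + x (x+y-1)_n,
-- written so that the subtraction never truncates a nonzero term.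
falling-split : ∀ x y n → y * falling (x + (y ∸ 1)) n + x * falling (x ∸ 1 + y) n ≡ falling (x + y) (suc n)
falling-split zero y n = +-identityʳ _
falling-split (suc x) zero n rewrite +-identityʳ x = refl
falling-split (suc x) (suc y) n rewrite +-suc x y = begin
  suc y * F + suc x * F     ≡⟨ sym (*-distribʳ-+ F (suc y) (suc x)) ⟩
  (suc y + suc x) * F       ≡⟨ cong (λ m → suc m * F) (≡-trans (+-suc y x) (cong suc (+-comm y x))) ⟩
  suc (suc (x + y)) * F     ∎
  where
  F : ℕ
  F = falling (suc (x + y)) n

if-* : ∀ b m n → (if b then m * n else 0) ≡ m * (if b then n else 0)
if-* true m n = refl
if-* false m n = sym (*-zeroʳ m)

sum-allRows-suc : ∀ c (f : Vec Bool (suc c) → ℕ) →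
  sumℕ f (allRows (suc c)) ≡ sumℕ (λ v → f (false ∷ v) + f (true ∷ v)) (allRows c)
sum-allRows-suc c f = go (allRows c)
  where
  go : (L : List (Vec Bool c)) →
    sumℕ f (concatMap (λ v → (false ∷ v) ∷ (true ∷ v) ∷ []) L) ≡ sumℕ (λ v → f (false ∷ v) + f (true ∷ v)) L
  go [] = refl
  go (v ∷ L) = ≡-trans (cong (λ t → f (false ∷ v) + (f (true ∷ v) + t)) (go L)) (sym (+-assoc (f (false ∷ v)) _ _))

sum-allArrays-suc : ∀ r c (f : Array (suc r) c → ℕ) →
  sumℕ f (allArrays (suc r) c) ≡ sumℕ (λ a → sumℕ (λ A → f (a ∷ A)) (allArrays r c)) (allRows c)
sum-allArrays-suc r c f = begin
  sumℕ f (allArrays (suc r) c)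
    ≡⟨ sum-concatMap f (λ A → map (_∷ A) (allRows c)) (allArrays r c) ⟩
  sumℕ (λ A → sumℕ f (map (_∷ A) (allRows c))) (allArrays r c)
    ≡⟨ sum-cong (allArrays r c) (λ A → sum-map f (_∷ A) (allRows c)) ⟩
  sumℕ (λ A → sumℕ (λ a → f (a ∷ A)) (allRows c)) (allArrays r c)
    ≡⟨ sum-swap (λ A a → f (a ∷ A)) (allArrays r c) (allRows c) ⟩
  sumℕ (λ a → sumℕ (λ A → f (a ∷ A)) (allArrays r c)) (allRows c) ∎

∈-allRows : ∀ {c} (v : Vec Bool c) → v ∈ allRows c
∈-allRows [] = here refl
∈-allRows (x ∷ v) = ∈-concat⁺′ (∈-pair x) (∈-map⁺ (λ w → (false ∷ w) ∷ (true ∷ w) ∷ []) (∈-allRows v))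
  where
  ∈-pair : ∀ x → x ∷ v ∈ (false ∷ v) ∷ (true ∷ v) ∷ []
  ∈-pair false = here refl
  ∈-pair true = there (here refl)

∈-allArrays : ∀ {r c} (A : Array r c) → A ∈ allArrays r c
∈-allArrays [] = here refl
∈-allArrays {c = c} (a ∷ A) =
  ∈-concat⁺′ (∈-map⁺ (_∷ A) (∈-allRows a)) (∈-map⁺ (λ B → map (_∷ B) (allRows c)) (∈-allArrays A))

rowCount-≤ : ∀ {c} (v : Vec Bool c) → rowCount v ≤ c
rowCount-≤ [] = z≤n
rowCount-≤ (true ∷ v) = s≤s (rowCount-≤ v)
rowCount-≤ (false ∷ v) = m≤n⇒m≤1+n (rowCount-≤ v)

rowSub-≤ : ∀ {c} (a b : Vec Bool c) → rowSub a b ≡ true → rowCount a ≤ rowCount b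
rowSub-≤ [] [] _ = z≤n
rowSub-≤ (true ∷ a) (true ∷ b) a⊆b = s≤s (rowSub-≤ a b a⊆b)
rowSub-≤ (false ∷ a) (true ∷ b) a⊆b = m≤n⇒m≤1+n (rowSub-≤ a b a⊆b)
rowSub-≤ (false ∷ a) (false ∷ b) a⊆b = rowSub-≤ a b a⊆b

rowSub-empty : ∀ {c} (b : Vec Bool c) → rowSub (replicate c false) b ≡ true
rowSub-empty [] = refl
rowSub-empty (_ ∷ b) = rowSub-empty b

orderedTerm : ∀ {c} → ℕ → Vec Bool c → ℕ
orderedTerm s v = δ (rowCount v) s * rowCount v !

-- Σ_{|v| = s} |v|! = (c)_s: ordered choices of s cells out of c.
sum-orderedTerm : ∀ c s → sumℕ (orderedTerm s) (allRows c) ≡ falling c s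
sum-orderedTerm zero zero = refl
sum-orderedTerm zero (suc s) = refl
sum-orderedTerm (suc c) zero = begin
  sumℕ (orderedTerm 0) (allRows (suc c))            ≡⟨ sum-allRows-suc c (orderedTerm 0) ⟩
  sumℕ (λ v → orderedTerm 0 v + 0) (allRows c)      ≡⟨ sum-cong (allRows c) (λ v → +-identityʳ _) ⟩
  sumℕ (orderedTerm 0) (allRows c)                  ≡⟨ sum-orderedTerm c 0 ⟩
  1                                                 ∎
sum-orderedTerm (suc c) (suc s) = begin
  sumℕ (orderedTerm (suc s)) (allRows (suc c))
    ≡⟨ sum-allRows-suc c (orderedTerm (suc s)) ⟩
  sumℕ (λ v → orderedTerm (suc s) v + δ (rowCount v) s * (suc (rowCount v) * rowCount v !)) (allRows c)
    ≡⟨ sum-cong (allRows c) (λ v → cong (orderedTerm (suc s) v +_) (δ-scale (rowCount v) s (rowCount v !))) ⟩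
  sumℕ (λ v → orderedTerm (suc s) v + suc s * orderedTerm s v) (allRows c)
    ≡⟨ sum-+ (orderedTerm (suc s)) (λ v → suc s * orderedTerm s v) (allRows c) ⟩
  sumℕ (orderedTerm (suc s)) (allRows c) + sumℕ (λ v → suc s * orderedTerm s v) (allRows c)
    ≡⟨ cong (sumℕ (orderedTerm (suc s)) (allRows c) +_) (sum-scale (suc s) (orderedTerm s) (allRows c)) ⟩
  sumℕ (orderedTerm (suc s)) (allRows c) + suc s * sumℕ (orderedTerm s) (allRows c)
    ≡⟨ cong₂ (λ p q → p + suc s * q) (sum-orderedTerm c (suc s)) (sum-orderedTerm c s) ⟩
  falling c (suc s) + suc s * falling c s
    ≡⟨ +-comm (falling c (suc s)) _ ⟩
  suc s * falling c s + falling c (suc s)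
    ≡⟨ sym (falling-pascal c s) ⟩
  falling (suc c) (suc s) ∎

subsetTerm : ∀ {c} → Vec Bool c → ℕ → ℕ → Vec Bool c → ℕ
subsetTerm b x y a = if rowSub a b then falling x (rowCount a) * falling y (rowCount b ∸ rowCount a) else 0

subset-vandermonde : ∀ {c} (b : Vec Bool c) (x y : ℕ) →
  sumℕ (subsetTerm b x y) (allRows c) ≡ falling (x + y) (rowCount b)
subset-vandermonde [] x y = refl
subset-vandermonde {suc c} (false ∷ b) x y = begin
  sumℕ (subsetTerm (false ∷ b) x y) (allRows (suc c))        ≡⟨ sum-allRows-suc c (subsetTerm (false ∷ b) x y) ⟩
  sumℕ (λ v → subsetTerm b x y v + 0) (allRows c)            ≡⟨ sum-cong (allRows c) (λ v → +-identityʳ _) ⟩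
  sumℕ (subsetTerm b x y) (allRows c)                        ≡⟨ subset-vandermonde b x y ⟩
  falling (x + y) (rowCount b)                               ∎
subset-vandermonde {suc c} (true ∷ b) x y = begin
  sumℕ (subsetTerm (true ∷ b) x y) (allRows (suc c))
    ≡⟨ sum-allRows-suc c (subsetTerm (true ∷ b) x y) ⟩
  sumℕ (λ v → subsetTerm (true ∷ b) x y (false ∷ v) + subsetTerm (true ∷ b) x y (true ∷ v)) (allRows c)
    ≡⟨ sum-cong (allRows c) split ⟩
  sumℕ (λ v → y * subsetTerm b x (y ∸ 1) v + x * subsetTerm b (x ∸ 1) y v) (allRows c)
    ≡⟨ sum-+ _ _ (allRows c) ⟩
  sumℕ (λ v → y * subsetTerm b x (y ∸ 1) v) (allRows c) + sumℕ (λ v → x * subsetTerm b (x ∸ 1) y v) (allRows c)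
    ≡⟨ cong₂ _+_ (sum-scale y (subsetTerm b x (y ∸ 1)) (allRows c)) (sum-scale x (subsetTerm b (x ∸ 1) y) (allRows c)) ⟩
  y * sumℕ (subsetTerm b x (y ∸ 1)) (allRows c) + x * sumℕ (subsetTerm b (x ∸ 1) y) (allRows c)
    ≡⟨ cong₂ (λ p q → y * p + x * q) (subset-vandermonde b x (y ∸ 1)) (subset-vandermonde b (x ∸ 1) y) ⟩
  y * falling (x + (y ∸ 1)) (rowCount b) + x * falling (x ∸ 1 + y) (rowCount b)
    ≡⟨ falling-split x y (rowCount b) ⟩
  falling (x + y) (suc (rowCount b)) ∎
  where
  -- The new cell of b is either left out of a (the y-factor loses one)
  -- or put into a (the x-factor loses one).
  split : ∀ v → subsetTerm (true ∷ b) x y (false ∷ v) + subsetTerm (true ∷ b) x y (true ∷ v)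
              ≡ y * subsetTerm b x (y ∸ 1) v + x * subsetTerm b (x ∸ 1) y v
  split v with rowSub v b in v⊆b
  ... | false = sym (cong₂ _+_ (*-zeroʳ y) (*-zeroʳ x))
  ... | true rewrite +-∸-assoc 1 (rowSub-≤ v b v⊆b) =
    rearrange x y (falling x (rowCount v)) (falling (x ∸ 1) (rowCount v)) _ _
    where
    rearrange : ∀ x y p p′ q q′ → p * (y * q′) + x * p′ * q ≡ y * (p * q′) + x * (p′ * q)
    rearrange = solve-∀

-- W u A = Π_i (u_i)_{A_i} where u_1 = u and u_{i+1} = u_i + (c - A_i).
-- For u = c this is the weight of the theorem, since u_i = c i - A_{<i}.
W : ∀ {k c} → ℕ → Array k c → ℕ
W u [] = 1
W {c = c} u (a ∷ A) = falling u (rowCount a) * W (u + (c ∸ rowCount a)) A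

weightFrom≡W : ∀ {k} c i p u (A : Array k c) → u + p ≡ c * i → weightFrom c i p A ≡ W u A
weightFrom≡W c i p u [] _ = refl
weightFrom≡W c i p u (a ∷ A) u+p≡ci =
  cong₂ _*_ (cong (λ t → falling t (rowCount a)) firstArg)
            (weightFrom≡W c (suc i) (p + rowCount a) (u + (c ∸ rowCount a)) A nextArg)
  where
  firstArg : c * i ∸ p ≡ u
  firstArg = ≡-trans (cong (_∸ p) (sym u+p≡ci)) (m+n∸n≡m u p)
  regroup : ∀ u d p a → u + d + (p + a) ≡ u + p + (d + a)
  regroup = solve-∀
  nextArg : u + (c ∸ rowCount a) + (p + rowCount a) ≡ c * suc i
  nextArg = begin
    u + (c ∸ rowCount a) + (p + rowCount a)   ≡⟨ regroup u (c ∸ rowCount a) p (rowCount a) ⟩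
    u + p + (c ∸ rowCount a + rowCount a)     ≡⟨ cong₂ _+_ u+p≡ci (m∸n+n≡m (rowCount-≤ a)) ⟩
    c * i + c                                 ≡⟨ +-comm (c * i) c ⟩
    c + c * i                                 ≡⟨ sym (*-suc c i) ⟩
    c * suc i                                 ∎

weight≡W : ∀ {k c} (A : Array k c) → weight A ≡ W c A
weight≡W {c = c} A = weightFrom≡W c 1 0 c A (≡-trans (+-identityʳ c) (sym (*-identityʳ c)))

W-pos : ∀ {k c} u (A : Array k c) → c ≤ u → 0 < W u A
W-pos u [] _ = s≤s z≤n
W-pos {c = c} u (a ∷ A) c≤u =
  *-pos (falling-pos u (rowCount a) (≤-trans (rowCount-≤ a) c≤u))
        (W-pos (u + (c ∸ rowCount a)) A (≤-trans c≤u (m≤m+n u _)))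
  where
  *-pos : ∀ {m n} → 0 < m → 0 < n → 0 < m * n
  *-pos {suc m} {n} _ 0<n = ≤-trans 0<n (m≤m+n n (m * n))

-- Q x A B is W x A with the bottom factor (x_r)_{A_r} replaced by A_r!, and set to 0 unless
-- every row of A but the bottom one is contained in the corresponding row of B
-- (equivalently A⁻ ⊂ b ∷ B for any row b).
Q : ∀ {k c} → ℕ → Array (suc k) c → Array k c → ℕ
Q {zero} x (a ∷ []) [] = rowCount a !
Q {suc k} {c} x (a ∷ A) (b ∷ B) =
  if rowSub a b then falling x (rowCount a) * Q (x + (c ∸ rowCount a)) A B else 0

-- The argument x_r of the falling factorial of the bottom row in W x A.
bottomArg : ∀ {k c} → ℕ → Array (suc k) c → ℕ
bottomArg {zero} x (a ∷ []) = x
bottomArg {suc k} {c} x (a ∷ A) = bottomArg (x + (c ∸ rowCount a)) A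

W-factor : ∀ {k c} x (A : Array (suc k) c) (B : Array k c) →
  (if sub (init A) B then W x A else 0) ≡ Q x A B * (bottomArg x A C rowCount (last A))
W-factor {zero} x (a ∷ []) [] = ≡-trans (*-identityʳ _) (falling≡!*C x (rowCount a))
W-factor {suc k} {c} x (a ∷ A) (b ∷ B) with rowSub a b
... | false = refl
... | true = begin
  (if sub (init A) B then falling x (rowCount a) * W x′ A else 0)
    ≡⟨ if-* (sub (init A) B) (falling x (rowCount a)) (W x′ A) ⟩
  falling x (rowCount a) * (if sub (init A) B then W x′ A else 0)
    ≡⟨ cong (falling x (rowCount a) *_) (W-factor x′ A B) ⟩
  falling x (rowCount a) * (Q x′ A B * (bottomArg x′ A C rowCount (last A)))
    ≡⟨ sym (*-assoc (falling x (rowCount a)) _ _) ⟩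
  falling x (rowCount a) * Q x′ A B * (bottomArg x′ A C rowCount (last A)) ∎
  where
  x′ : ℕ
  x′ = x + (c ∸ rowCount a)

bottomArg-≥ : ∀ {k c} x (A : Array (suc k) c) → x ≤ bottomArg x A
bottomArg-≥ {zero} x (a ∷ []) = ≤-refl
bottomArg-≥ {suc k} {c} x (a ∷ A) = ≤-trans (m≤m+n x _) (bottomArg-≥ (x + (c ∸ rowCount a)) A)

-- Each row above the bottom one adds c free cells and uses up its balls.
bottomArg-balls : ∀ {k c} x (A : Array (suc k) c) → bottomArg x A + balls (init A) ≡ x + k * c
bottomArg-balls {zero} x (a ∷ []) = refl
bottomArg-balls {suc k} {c} x (a ∷ A) = begin
  bottomArg x′ A + (rowCount a + balls (init A))   ≡⟨ regroup (bottomArg x′ A) (rowCount a) (balls (init A)) ⟩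
  bottomArg x′ A + balls (init A) + rowCount a     ≡⟨ cong (_+ rowCount a) (bottomArg-balls x′ A) ⟩
  x + (c ∸ rowCount a) + k * c + rowCount a        ≡⟨ regroup′ x (c ∸ rowCount a) (k * c) (rowCount a) ⟩
  x + (c ∸ rowCount a + rowCount a) + k * c        ≡⟨ cong (λ t → x + t + k * c) (m∸n+n≡m (rowCount-≤ a)) ⟩
  x + c + k * c                                    ≡⟨ +-assoc x c (k * c) ⟩
  x + suc k * c                                    ∎
  where
  x′ : ℕ
  x′ = x + (c ∸ rowCount a)
  regroup : ∀ p q r → p + (q + r) ≡ p + r + q
  regroup = solve-∀
  regroup′ : ∀ x d e a → x + d + e + a ≡ x + (d + a) + e
  regroup′ = solve-∀

balls-init-last : ∀ {k c} (A : Array (suc k) c) → balls A ≡ balls (init A) + rowCount (last A)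
balls-init-last {zero} (a ∷ []) = +-identityʳ (rowCount a)
balls-init-last {suc k} (a ∷ A) = ≡-trans (cong (rowCount a +_) (balls-init-last A)) (sym (+-assoc (rowCount a) _ _))

binomialTop : ∀ {k c} (A : Array (suc k) c) → suc k * c ∸ balls A + rowCount (last A) ≡ bottomArg c A
binomialTop {k} {c} A = begin
  suc k * c ∸ balls A + n                 ≡⟨ cong (λ t → suc k * c ∸ t + n) (balls-init-last A) ⟩
  suc k * c ∸ (m + n) + n                 ≡⟨ cong (λ t → t ∸ (m + n) + n) (sym (≡-trans (+-comm m L) (bottomArg-balls c A))) ⟩
  m + L ∸ (m + n) + n                     ≡⟨ cong (_+ n) ([m+n]∸[m+o]≡n∸o m L n) ⟩
  L ∸ n + n                               ≡⟨ m∸n+n≡m (≤-trans (rowCount-≤ (last A)) (bottomArg-≥ c A)) ⟩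
  L                                       ∎
  where
  m n L : ℕ
  m = balls (init A)
  n = rowCount (last A)
  L = bottomArg c A

bottomBinomial-pos : ∀ {k} c (A : Array (suc k) c) → 0 < bottomArg c A C rowCount (last A)
bottomBinomial-pos c A = C-pos (≤-trans (rowCount-≤ (last A)) (bottomArg-≥ c A))

∸-split : ∀ {c} p d → p + d ≤ c → c ∸ p ≡ d + (c ∸ (p + d))
∸-split {c} p d p+d≤c = begin
  c ∸ p                          ≡⟨ cong (_∸ p) (sym (m+[n∸m]≡n p+d≤c)) ⟩
  p + d + (c ∸ (p + d)) ∸ p      ≡⟨ cong (_∸ p) (+-assoc p d _) ⟩
  p + (d + (c ∸ (p + d))) ∸ p    ≡⟨ m+n∸m≡n p _ ⟩
  d + (c ∸ (p + d))              ∎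

∸-exchange : ∀ {c} p q d → p + d ≤ c → q + d ≤ c → (c ∸ p) + (c ∸ (q + d)) ≡ (c ∸ q) + (c ∸ (p + d))
∸-exchange {c} p q d p+d≤c q+d≤c = begin
  (c ∸ p) + (c ∸ (q + d))              ≡⟨ cong (_+ (c ∸ (q + d))) (∸-split p d p+d≤c) ⟩
  d + (c ∸ (p + d)) + (c ∸ (q + d))    ≡⟨ swap d (c ∸ (p + d)) (c ∸ (q + d)) ⟩
  d + (c ∸ (q + d)) + (c ∸ (p + d))    ≡⟨ cong (_+ (c ∸ (p + d))) (sym (∸-split q d q+d≤c)) ⟩
  (c ∸ q) + (c ∸ (p + d))              ∎
  where
  swap : ∀ a b c → a + b + c ≡ a + c + b
  swap = solve-∀

falling-guard : ∀ c n {p q} → (n ≤ c → p ≡ q) → falling c n * p ≡ falling c n * q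
falling-guard c n {p} {q} p≡q with n ≤? c
... | yes n≤c = cong (falling c n *_) (p≡q n≤c)
... | no n≰c = ≡-trans (cong (_* p) vanish) (sym (cong (_* q) vanish))
  where
  vanish : falling c n ≡ 0
  vanish = falling-zero c n (≰⇒> n≰c)

δ-pull : ∀ a d s n m p q {b} → a + d ≡ b →
  δ (a + n) (s + (b + m)) * (p * q) ≡ p * (δ n (s + d + m) * q)
δ-pull a d s n m p q refl = begin
  δ (a + n) (s + (a + d + m)) * (p * q)   ≡⟨ cong (λ t → δ (a + n) t * (p * q)) (shuffle s a d m) ⟩
  δ (a + n) (a + (s + d + m)) * (p * q)   ≡⟨ cong (_* (p * q)) (δ-cancel a n (s + d + m)) ⟩
  δ n (s + d + m) * (p * q)               ≡⟨ swap (δ n (s + d + m)) p q ⟩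
  p * (δ n (s + d + m) * q)               ∎
  where
  shuffle : ∀ s a d m → s + (a + d + m) ≡ a + (s + d + m)
  shuffle = solve-∀
  swap : ∀ p q r → p * (q * r) ≡ q * (p * r)
  swap = solve-∀

shiftedArg : ∀ x {c} a s d {b} → a + d ≡ b → b ≤ c → s + d ≤ c →
  x + (c ∸ a) + (c ∸ (s + d)) ≡ x + (c ∸ s) + (c ∸ b)
shiftedArg x {c} a s d refl b≤c s+d≤c = begin
  x + (c ∸ a) + (c ∸ (s + d))     ≡⟨ +-assoc x _ _ ⟩
  x + ((c ∸ a) + (c ∸ (s + d)))   ≡⟨ cong (x +_) (∸-exchange a s d b≤c s+d≤c) ⟩
  x + ((c ∸ s) + (c ∸ (a + d)))   ≡⟨ sym (+-assoc x _ _) ⟩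
  x + (c ∸ s) + (c ∸ (a + d))     ∎

-- Summing out the top row a of A is Vandermonde's identity over the subrows a ⊆ b of the
-- top row b of B; the remaining rows are handled by induction.
sum-Q : ∀ {k c} x s (B : Array k c) →
  sumℕ (λ A → δ (balls A) (s + balls B) * Q x A B) (allArrays (suc k) c) ≡ falling c s * W (x + (c ∸ s)) B
sum-Q {zero} {c} x s [] = begin
  sumℕ (λ A → δ (balls A) (s + 0) * Q x A []) (allArrays 1 c)
    ≡⟨ sum-allArrays-suc 0 c (λ A → δ (balls A) (s + 0) * Q x A []) ⟩
  sumℕ (λ a → δ (rowCount a + 0) (s + 0) * rowCount a ! + 0) (allRows c)
    ≡⟨ sum-cong (allRows c) dropZeros ⟩
  sumℕ (orderedTerm s) (allRows c)
    ≡⟨ sum-orderedTerm c s ⟩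
  falling c s
    ≡⟨ sym (*-identityʳ _) ⟩
  falling c s * 1 ∎
  where
  dropZeros : ∀ a → δ (rowCount a + 0) (s + 0) * rowCount a ! + 0 ≡ orderedTerm s a
  dropZeros a = ≡-trans (+-identityʳ _)
    (cong₂ (λ m n → δ m n * rowCount a !) (+-identityʳ (rowCount a)) (+-identityʳ s))
sum-Q {suc k} {c} x s (b ∷ B) = begin
  sumℕ F (allArrays (suc (suc k)) c)
    ≡⟨ sum-allArrays-suc (suc k) c F ⟩
  sumℕ (λ a → sumℕ (λ A → F (a ∷ A)) (allArrays (suc k) c)) (allRows c)
    ≡⟨ sum-cong (allRows c) topRow ⟩
  sumℕ (λ a → K * subsetTerm b x (c ∸ s) a) (allRows c)
    ≡⟨ sum-scale K (subsetTerm b x (c ∸ s)) (allRows c) ⟩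
  K * sumℕ (subsetTerm b x (c ∸ s)) (allRows c)
    ≡⟨ cong (K *_) (subset-vandermonde b x (c ∸ s)) ⟩
  K * falling u (rowCount b)
    ≡⟨ *-assoc (falling c s) _ _ ⟩
  falling c s * (W (u + (c ∸ rowCount b)) B * falling u (rowCount b))
    ≡⟨ cong (falling c s *_) (*-comm (W (u + (c ∸ rowCount b)) B) _) ⟩
  falling c s * W u (b ∷ B) ∎
  where
  F : Array (suc (suc k)) c → ℕ
  F A = δ (balls A) (s + balls (b ∷ B)) * Q x A (b ∷ B)
  u K : ℕ
  u = x + (c ∸ s)
  K = falling c s * W (u + (c ∸ rowCount b)) B
  topRow : ∀ a → sumℕ (λ A → F (a ∷ A)) (allArrays (suc k) c) ≡ K * subsetTerm b x (c ∸ s) a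
  topRow a with rowSub a b in a⊆b
  ... | false = begin
    sumℕ (λ A → δ (rowCount a + balls A) (s + balls (b ∷ B)) * 0) (allArrays (suc k) c)
      ≡⟨ sum-cong (allArrays (suc k) c) (λ A → *-zeroʳ (δ (rowCount a + balls A) _)) ⟩
    sumℕ (λ _ → 0) (allArrays (suc k) c)
      ≡⟨ sum-zero (allArrays (suc k) c) ⟩
    0
      ≡⟨ sym (*-zeroʳ K) ⟩
    K * 0 ∎
  ... | true = begin
    sumℕ (λ A → δ (ca + balls A) (s + (cb + balls B)) * (falling x ca * Q x′ A B)) (allArrays (suc k) c)
      ≡⟨ sum-cong (allArrays (suc k) c) (λ A → δ-pull ca d s (balls A) (balls B) (falling x ca) (Q x′ A B) ca+d≡cb) ⟩
    sumℕ (λ A → falling x ca * (δ (balls A) (s + d + balls B) * Q x′ A B)) (allArrays (suc k) c)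
      ≡⟨ sum-scale (falling x ca) _ (allArrays (suc k) c) ⟩
    falling x ca * sumℕ (λ A → δ (balls A) (s + d + balls B) * Q x′ A B) (allArrays (suc k) c)
      ≡⟨ cong (falling x ca *_) (sum-Q x′ (s + d) B) ⟩
    falling x ca * (falling c (s + d) * W (x′ + (c ∸ (s + d))) B)
      ≡⟨ cong (falling x ca *_) (falling-guard c (s + d) (λ s+d≤c → cong (λ t → W t B) (shiftedArg x ca s d ca+d≡cb (rowCount-≤ b) s+d≤c))) ⟩
    falling x ca * (falling c (s + d) * W (u + (c ∸ cb)) B)
      ≡⟨ cong (λ t → falling x ca * (t * W (u + (c ∸ cb)) B)) (falling-add c s d) ⟩
    falling x ca * (falling c s * falling (c ∸ s) d * W (u + (c ∸ cb)) B)
      ≡⟨ regroup (falling x ca) (falling c s) (falling (c ∸ s) d) (W (u + (c ∸ cb)) B) ⟩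
    K * (falling x ca * falling (c ∸ s) d) ∎
    where
    ca cb d x′ : ℕ
    ca = rowCount a
    cb = rowCount b
    d = cb ∸ ca
    x′ = x + (c ∸ ca)
    ca+d≡cb : ca + d ≡ cb
    ca+d≡cb = m+[n∸m]≡n (rowSub-≤ a b a⊆b)
    regroup : ∀ p f g w → p * (f * g * w) ≡ f * w * (p * g)
    regroup = solve-∀

ι : ℕ → ℚ
ι n = ℤ.+ n / 1

toℚᵘ-/ : ∀ a d → toℚᵘ (ℤ.+ a / suc d) ≃ᵘ mkℚᵘ (ℤ.+ a) d
toℚᵘ-/ a d = ℚP.toℚᵘ-fromℚᵘ (mkℚᵘ (ℤ.+ a) d)

ι-+ : ∀ m n → ι (m + n) ≡ ι m +ℚ ι n
ι-+ m n = ℚP.toℚᵘ-injective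
  (ℚᵘP.≃-trans (toℚᵘ-/ (m + n) 0)
  (ℚᵘP.≃-trans sumᵘ
  (ℚᵘP.≃-sym (ℚᵘP.≃-trans (ℚP.toℚᵘ-homo-+ (ι m) (ι n)) (ℚᵘP.+-cong (toℚᵘ-/ m 0) (toℚᵘ-/ n 0))))))
  where
  sumᵘ : mkℚᵘ (ℤ.+ (m + n)) 0 ≃ᵘ mkℚᵘ (ℤ.+ m) 0 +ᵘ mkℚᵘ (ℤ.+ n) 0
  sumᵘ = *≡* (≡-trans (ℤP.*-identityʳ _) (≡-trans (ℤP.pos-+ m n)
           (≡-trans (cong₂ ℤ._+_ (sym (ℤP.*-identityʳ (ℤ.+ m))) (sym (ℤP.*-identityʳ (ℤ.+ n))))
                    (sym (ℤP.*-identityʳ _)))))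

ι-cancel : ∀ q d → ι (q * suc d) *ℚ inv (suc d) ≡ ι q
ι-cancel q d = ℚP.toℚᵘ-injective
  (ℚᵘP.≃-trans (ℚP.toℚᵘ-homo-* (ι (q * suc d)) (inv (suc d)))
  (ℚᵘP.≃-trans (ℚᵘP.*-cong (toℚᵘ-/ (q * suc d) 0) (toℚᵘ-/ 1 d))
  (ℚᵘP.≃-trans productᵘ (ℚᵘP.≃-sym (toℚᵘ-/ q 0)))))
  where
  productᵘ : mkℚᵘ (ℤ.+ (q * suc d)) 0 *ᵘ mkℚᵘ (ℤ.+ 1) d ≃ᵘ mkℚᵘ (ℤ.+ q) 0
  productᵘ = *≡* (≡-trans (ℤP.*-identityʳ _) (≡-trans (ℤP.*-identityʳ _)
               (≡-trans (ℤP.pos-* q (suc d)) (cong (λ t → ℤ.+ q ℤ.* ℤ.+ suc t) (sym (+-identityʳ d))))))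

sumℚ-ι : ∀ {X : Set} (f : X → ℕ) (z : ℚ) (L : List X) → sumℚ (λ x → ι (f x) *ℚ z) L ≡ ι (sumℕ f L) *ℚ z
sumℚ-ι f z [] = sym (ℚP.*-zeroˡ z)
sumℚ-ι f z (x ∷ L) = begin
  ι (f x) *ℚ z +ℚ sumℚ (λ y → ι (f y) *ℚ z) L   ≡⟨ cong (ι (f x) *ℚ z +ℚ_) (sumℚ-ι f z L) ⟩
  ι (f x) *ℚ z +ℚ ι (sumℕ f L) *ℚ z             ≡⟨ sym (ℚP.*-distribʳ-+ z (ι (f x)) _) ⟩
  (ι (f x) +ℚ ι (sumℕ f L)) *ℚ z                ≡⟨ cong (_*ℚ z) (sym (ι-+ (f x) _)) ⟩
  ι (f x + sumℕ f L) *ℚ z                       ∎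

sumℚ-cong : ∀ {X : Set} {g h : X → ℚ} {L : List X} → All (λ x → g x ≡ h x) L → sumℚ g L ≡ sumℚ h L
sumℚ-cong [] = refl
sumℚ-cong (gx≡hx ∷ g≗h) = cong₂ _+ℚ_ gx≡hx (sumℚ-cong g≗h)

divide-out : ∀ w q N (z : ℚ) → w ≡ q * N → 0 < N → ι w *ℚ z *ℚ inv N ≡ ι q *ℚ z
divide-out .(q * suc d) q (suc d) z refl _ = begin
  ι (q * suc d) *ℚ z *ℚ inv (suc d)      ≡⟨ ℚP.*-assoc (ι (q * suc d)) z _ ⟩
  ι (q * suc d) *ℚ (z *ℚ inv (suc d))    ≡⟨ cong (ι (q * suc d) *ℚ_) (ℚP.*-comm z _) ⟩
  ι (q * suc d) *ℚ (inv (suc d) *ℚ z)    ≡⟨ sym (ℚP.*-assoc (ι (q * suc d)) _ z) ⟩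
  ι (q * suc d) *ℚ inv (suc d) *ℚ z      ≡⟨ cong (_*ℚ z) (ι-cancel q d) ⟩
  ι q *ℚ z                               ∎

-- π(A) P(A → B) = Q(A, B⁻)/Z for every A with ℓ balls, where B = b ∷ B⁻:
-- the binomial coefficient of the transition cancels the bottom factor of the weight of A.
flow : ∀ k c ℓ (b : Vec Bool c) (B : Array k c) (A : Array (suc k) c) → balls A ≡ ℓ →
  π (suc k) c ℓ A *ℚ trans (suc k) c ℓ A (b ∷ B) ≡ ι (Q c A B) *ℚ inv (Z (suc k) c ℓ)
flow k c ℓ b B A refl rewrite rowSub-empty b with sub (init A) B | W-factor c A B
... | true | W≡QN = begin
  π (suc k) c (balls A) A *ℚ inv ((suc k * c ∸ balls A + rowCount (last A)) C rowCount (last A))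
    ≡⟨ cong (λ t → π (suc k) c (balls A) A *ℚ inv (t C rowCount (last A))) (binomialTop A) ⟩
  π (suc k) c (balls A) A *ℚ inv (bottomArg c A C rowCount (last A))
    ≡⟨ divide-out (weight A) (Q c A B) _ _ (≡-trans (weight≡W A) W≡QN) (bottomBinomial-pos c A) ⟩
  ι (Q c A B) *ℚ inv (Z (suc k) c (balls A)) ∎
... | false | 0≡QN = begin
  π (suc k) c (balls A) A *ℚ 0ℚ         ≡⟨ ℚP.*-zeroʳ (π (suc k) c (balls A) A) ⟩
  0ℚ                                    ≡⟨ sym (ℚP.*-zeroˡ (inv (Z (suc k) c (balls A)))) ⟩
  ι 0 *ℚ inv (Z (suc k) c (balls A))     ≡⟨ cong (λ t → ι t *ℚ inv (Z (suc k) c (balls A))) (sym Q≡0) ⟩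
  ι (Q c A B) *ℚ inv (Z (suc k) c (balls A)) ∎
  where
  Q≡0 : Q c A B ≡ 0
  Q≡0 = m*n≡0⇒m≡0 (Q c A B) _ {{>-nonZero (bottomBinomial-pos c A)}} (sym 0≡QN)

-- Global balance: Σ_{A ∈ S} π(A) P(A → B) = π(B).  Summing the flows of `flow` and
-- applying `sum-Q` with x = c and s = B_1 recovers the weight of B.
stationary : ∀ r c ℓ (B : Array r c) → balls B ≡ ℓ →
  sumℚ (λ A → π r c ℓ A *ℚ trans r c ℓ A B) (S r c ℓ) ≡ π r c ℓ B
stationary zero c .0 [] refl = refl
stationary (suc k) c ℓ (b ∷ B) |B|≡ℓ = begin
  sumℚ (λ A → π (suc k) c ℓ A *ℚ trans (suc k) c ℓ A (b ∷ B)) (S (suc k) c ℓ)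
    ≡⟨ sumℚ-cong (All.map (flow k c ℓ b B _) (all-filter (λ A → balls A ≟ ℓ) (allArrays (suc k) c))) ⟩
  sumℚ (λ A → ι (Q c A B) *ℚ z) (S (suc k) c ℓ)
    ≡⟨ sumℚ-ι (λ A → Q c A B) z (S (suc k) c ℓ) ⟩
  ι (sumℕ (λ A → Q c A B) (S (suc k) c ℓ)) *ℚ z
    ≡⟨ cong (λ t → ι t *ℚ z) inflow ⟩
  ι (weight (b ∷ B)) *ℚ z ∎
  where
  z : ℚ
  z = inv (Z (suc k) c ℓ)
  inflow : sumℕ (λ A → Q c A B) (S (suc k) c ℓ) ≡ weight (b ∷ B)
  inflow = begin
    sumℕ (λ A → Q c A B) (S (suc k) c ℓ)
      ≡⟨ sum-filter (λ A → Q c A B) balls ℓ (allArrays (suc k) c) ⟩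
    sumℕ (λ A → δ (balls A) ℓ * Q c A B) (allArrays (suc k) c)
      ≡⟨ cong (λ n → sumℕ (λ A → δ (balls A) n * Q c A B) (allArrays (suc k) c)) (sym |B|≡ℓ) ⟩
    sumℕ (λ A → δ (balls A) (rowCount b + balls B) * Q c A B) (allArrays (suc k) c)
      ≡⟨ sum-Q c (rowCount b) B ⟩
    W c (b ∷ B)
      ≡⟨ sym (weight≡W (b ∷ B)) ⟩
    weight (b ∷ B) ∎

prefixRow : (c j : ℕ) → Vec Bool c
prefixRow zero j = []
prefixRow (suc c) zero = false ∷ prefixRow c zero
prefixRow (suc c) (suc j) = true ∷ prefixRow c j

rowCount-prefixRow : ∀ c j → rowCount (prefixRow c j) ≡ c ⊓ j
rowCount-prefixRow zero j = refl
rowCount-prefixRow (suc c) zero = ≡-trans (rowCount-prefixRow c zero) (⊓-zeroʳ c)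
rowCount-prefixRow (suc c) (suc j) = cong suc (rowCount-prefixRow c j)

fillArray : (r c ℓ : ℕ) → Array r c
fillArray zero c ℓ = []
fillArray (suc r) c ℓ = prefixRow c ℓ ∷ fillArray r c (ℓ ∸ c)

balls-fillArray : ∀ r c ℓ → ℓ ≤ r * c → balls (fillArray r c ℓ) ≡ ℓ
balls-fillArray zero c .0 z≤n = refl
balls-fillArray (suc r) c ℓ ℓ≤rc = begin
  rowCount (prefixRow c ℓ) + balls (fillArray r c (ℓ ∸ c))   ≡⟨ cong₂ _+_ (rowCount-prefixRow c ℓ) (balls-fillArray r c (ℓ ∸ c) rest≤) ⟩
  c ⊓ ℓ + (ℓ ∸ c)                                            ≡⟨ m⊓n+n∸m≡n c ℓ ⟩
  ℓ                                                          ∎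
  where
  rest≤ : ℓ ∸ c ≤ r * c
  rest≤ = ≤-trans (∸-monoˡ-≤ c ℓ≤rc) (≤-reflexive (m+n∸m≡n c (r * c)))

-- S_{r×c,ℓ} contains fillArray r c ℓ, whose weight is positive.
Z-pos : ∀ r c ℓ → ℓ ≤ r * c → 0 < Z r c ℓ
Z-pos r c ℓ ℓ≤rc = <-≤-trans weight-pos (∈⇒≤sum weight A∈S)
  where
  A : Array r c
  A = fillArray r c ℓ
  A∈S : A ∈ S r c ℓ
  A∈S = ∈-filter⁺ (λ A → balls A ≟ ℓ) (∈-allArrays A) (balls-fillArray r c ℓ ℓ≤rc)
  weight-pos : 0 < weight A
  weight-pos = subst (0 <_) (sym (weight≡W A)) (W-pos c A ≤-refl)

theorem4p2 : (r c ℓ : ℕ) → ℓ ≤ r * c →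
    (0 < Z r c ℓ)
    × ((B : Array r c) → balls B ≡ ℓ →
        sumℚ (λ A → π r c ℓ A *ℚ trans r c ℓ A B) (S r c ℓ) ≡ π r c ℓ B)
theorem4p2 r c ℓ ℓ≤rc = Z-pos r c ℓ ℓ≤rc , stationary r c ℓ
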